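{- Let $n\ge 1$, let $\lambda=n^2$ be the two-row shape with both rows of length $n$, and let $\rho$ be a density with $\rho_{1,j}=a_j>0$ and $\rho_{2,j}=b_j>0$ for all $1\le j\le n$; put $a=\sum_j a_j$, $b=\sum_j b_j$. Define $P_{max}=E^{a_1}N^{b_1}E^{a_2}N^{b_2}\cdots E^{a_n}N^{b_n}\in\mathcal{P}$. Then $\mathrm{SVT}(\lambda,\rho)$ is in bijection with $I=\{P\in\mathcal{P}: P\le P_{max}\}$.
   Context: Cell $(i,j)$ is in row $i$, column $j$. A standard set-valued Young tableau of shape $\lambda$ and density $\rho$ is an assignment to each cell $(i,j)$ of a set of exactly $\rho_{i,j}$ integers, these sets partitioning $\{1,\dots,a+b\}$, such that every integer in cell $(i,j)$ is smaller than every integer in cells $(i,j+1)$ and $(i+1,j)$ when these exist; $\mathrm{SVT}(\lambda,\rho)$ is the set of such tableaux. $\mathcal{P}$ is the set of lattice paths from $(0,0)$ to $(a,b)$ using steps $E=(1,0)$ and $N=(0,1)$ (written as words in $E,N$). For $P_1,P_2\in\mathcal{P}$, $P_1\le P_2$ means $P_1$ lies weakly below $P_2$ over $0\le x\le a$. -}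

module Defs where

open import Level using (0ℓ)
open import Data.Nat as ℕ using (ℕ; zero; suc; _+_)
open import Data.Fin as Fin using (Fin; toℕ)
open import Data.Fin.Properties using () renaming (_≟_ to _≟ᶠ_)
open import Data.Product using (Σ; _×_; _,_; proj₁)
open import Data.Product.Properties using (≡-dec)
open import Data.Vec as Vec using (Vec; lookup; count; sum)
open import Data.List as List using (List; []; _∷_; _++_; replicate)
open import Relation.Binary.PropositionalEquality using (_≡_; setoid)
open import Relation.Binary.Bundles using (Setoid)
import Relation.Binary.Construct.On as On
open import Relation.Nullary using (Dec; yes; no)

-- Two-row shape λ = n² : cells (i , j), row i ∈ Fin 2 (0 = first row,
-- 1 = second row), column j ∈ Fin n (0-based).

Cell : ℕ → Set
Cell n = Fin 2 × Fin n

_≟c_ : ∀ {n} (c d : Cell n) → Dec (c ≡ d)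
_≟c_ = ≡-dec _≟ᶠ_ _≟ᶠ_

ρ : ∀ {n} → Vec ℕ n → Vec ℕ n → Cell n → ℕ
ρ a b (Fin.zero  , j) = lookup a j
ρ a b (Fin.suc _ , j) = lookup b j

data Succ {n : ℕ} : Cell n → Cell n → Set where
  right : ∀ i (j j' : Fin n) → toℕ j' ≡ suc (toℕ j) → Succ (i , j) (i , j')
  below : ∀ (j : Fin n) → Succ (Fin.zero , j) (Fin.suc Fin.zero , j)

-- A set-valued filling with entries {1,…,N} is encoded by the vector
-- v : Vec (Cell n) N where lookup v k is the cell containing the integer
-- k+1 (this is exactly a partition of {1,…,N} into blocks labelled by cells).
IsSVT : ∀ {n N} → Vec ℕ n → Vec ℕ n → Vec (Cell n) N → Set
IsSVT {n} {N} a b v =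
  ((c : Cell n) → count (_≟c c) v ≡ ρ a b c)
  × ((x y : Fin N) → Succ (lookup v x) (lookup v y) → x Fin.< y)

SVT : ∀ {n} → Vec ℕ n → Vec ℕ n → Set
SVT a b = Σ (Vec (Cell _) (sum a + sum b)) (IsSVT a b)

SVT-setoid : ∀ {n} → Vec ℕ n → Vec ℕ n → Setoid 0ℓ 0ℓ
SVT-setoid a b = On.setoid {B = SVT a b} (setoid _) proj₁

data Step : Set where
  E N : Step

isE? : (s : Step) → Dec (s ≡ E)
isE? E = yes _≡_.refl
isE? N = no λ ()

isN? : (s : Step) → Dec (s ≡ N)
isN? N = yes _≡_.refl
isN? E = no λ ()

Path : ℕ → ℕ → Set
Path A B = Σ (List Step) λ w → List.length (List.filter isE? w) ≡ A
                               × List.length (List.filter isN? w) ≡ B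

-- heightAfter w i : the y-coordinate of the path w on the open strip
-- i < x < i+1, i.e. the number of N steps preceding the (i+1)-th E step.
heightAfter : List Step → ℕ → ℕ
heightAfter []      i       = 0
heightAfter (N ∷ w) i       = suc (heightAfter w i)
heightAfter (E ∷ w) zero    = 0
heightAfter (E ∷ w) (suc i) = heightAfter w i

-- P ≤ Q : P lies weakly below Q over 0 ≤ x ≤ A (for paths with common
-- endpoints this is equivalent to comparing heights on every strip).
_≼_ : ∀ {A B} → Path A B → List Step → Set
_≼_ {A} P Q = (i : Fin A) → heightAfter (proj₁ P) (toℕ i) ℕ.≤ heightAfter Q (toℕ i)

Pmax : ∀ {n} → Vec ℕ n → Vec ℕ n → List Step
Pmax Vec.[]       Vec.[]       = []
Pmax (x Vec.∷ a) (y Vec.∷ b) = replicate x E ++ replicate y N ++ Pmax a b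

I : ∀ {n} → Vec ℕ n → Vec ℕ n → Set
I a b = Σ (Path (sum a) (sum b)) λ P → P ≼ Pmax a b

I-setoid : ∀ {n} → Vec ℕ n → Vec ℕ n → Setoid 0ℓ 0ℓ
I-setoid a b = On.setoid {B = I a b} (setoid _) (λ P → proj₁ (proj₁ P))

-- Reading the entries 1, …, a + b in increasing order and recording E for an entry of the first row
-- and N for one of the second turns a tableau into a lattice path.  Since entries increase along
-- rows and no cell is empty, the entry of rank k within a row lies in the cell whose block of a_j
-- (resp. b_j) consecutive ranks contains k; so a tableau is recovered from its word, and every word
-- with the right numbers of letters decodes to a filling with the right cell sizes and increasing
-- rows.  The column condition says that the last entry of cell (1, j), the (a_1 + ⋯ + a_j)-th E,
-- precedes the first entry of cell (2, j), the (b_1 + ⋯ + b_{j-1} + 1)-th N: the path has height at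
-- most b_1 + ⋯ + b_{j-1} on the strips of its E steps a_1 + ⋯ + a_{j-1} + 1, …, a_1 + ⋯ + a_j,
-- which is the height of P_max there.

module Submission where

open import Level using (0ℓ)
open import Defs
open import Data.Nat using (ℕ; zero; suc; _+_; _∸_; _≤_; _<_; z≤n; s≤s; s≤s⁻¹; z<s; _≤?_; _<?_)
open import Data.Nat.Properties
open import Data.Fin as Fin using (Fin; toℕ)
open import Data.Fin.Properties using (toℕ<n; toℕ-fromℕ<; toℕ-injective) renaming (_≟_ to _≟ᶠ_)
open import Data.Vec as Vec using (Vec; []; _∷_; lookup; sum; toList; tabulate)
open import Data.Vec.Properties
  using (lookup∘tabulate; lookup-map; tabulate-∘; tabulate-cong; tabulate∘lookup; toList-injective; toList-cast; toList∘fromList)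
open import Data.Vec.Relation.Binary.Equality.Cast using (cast-is-id)
open import Data.List as List using (_++_; replicate)
open import Data.Product using (∃; _×_; _,_; proj₁; proj₂)
open import Data.Product.Properties using (,-injectiveˡ; ,-injectiveʳ)
open import Function using (_∘_)
open import Function.Bundles using (Bijection; Inverse)
open import Function.Properties.Inverse using (Inverse⇒Bijection)
open import Relation.Binary.Definitions using (DecidableEquality)
open import Relation.Binary.PropositionalEquality
open import Relation.Nullary using (¬_; Dec; yes; no; contradiction)
open import Relation.Nullary.Decidable using (_×-dec_)
open import Relation.Unary using (Pred; Decidable)
open import Relation.Unary.Properties using (_∩?_; ∁?)

card : ∀ {K} {P : Pred (Fin K) 0ℓ} → Decidable P → ℕ
card {zero}  P? = 0
card {suc K} P? with P? Fin.zero
... | yes _ = suc (card (P? ∘ Fin.suc))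
... | no  _ = card (P? ∘ Fin.suc)

private variable
  K : ℕ
  P Q : Pred (Fin K) 0ℓ

card-here : (P? : Decidable P) → P Fin.zero → card {suc K} P? ≡ suc (card (P? ∘ Fin.suc))
card-here P? p with P? Fin.zero
... | yes _  = refl
... | no ¬p = contradiction p ¬p

card-there : (P? : Decidable P) → ¬ P Fin.zero → card {suc K} P? ≡ card (P? ∘ Fin.suc)
card-there P? ¬p with P? Fin.zero
... | yes p = contradiction p ¬p
... | no _  = refl

card-suc : (P? : Decidable P) → card {suc K} P? ≡ card {1} (λ _ → P? Fin.zero) + card (P? ∘ Fin.suc)
card-suc P? with P? Fin.zero
... | yes _ = refl
... | no  _ = refl

card-mono : (P? : Decidable P) (Q? : Decidable Q) → (∀ i → P i → Q i) → card P? ≤ card Q?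
card-mono {zero}  P? Q? P⊆Q = z≤n
card-mono {suc K} P? Q? P⊆Q with P? Fin.zero | Q? Fin.zero
... | yes _  | yes _  = s≤s (card-mono (P? ∘ Fin.suc) (Q? ∘ Fin.suc) (P⊆Q ∘ Fin.suc))
... | yes p  | no ¬q  = contradiction (P⊆Q Fin.zero p) ¬q
... | no _   | yes _  = m≤n⇒m≤1+n (card-mono (P? ∘ Fin.suc) (Q? ∘ Fin.suc) (P⊆Q ∘ Fin.suc))
... | no _   | no _   = card-mono (P? ∘ Fin.suc) (Q? ∘ Fin.suc) (P⊆Q ∘ Fin.suc)

card-cong : (P? : Decidable P) (Q? : Decidable Q) →
            (∀ i → P i → Q i) → (∀ i → Q i → P i) → card P? ≡ card Q?
card-cong P? Q? P⊆Q Q⊆P = ≤-antisym (card-mono P? Q? P⊆Q) (card-mono Q? P? Q⊆P)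

card-split : (P? : Decidable P) (Q? : Decidable Q) →
             card P? ≡ card (P? ∩? Q?) + card (P? ∩? ∁? Q?)
card-split {zero}  P? Q? = refl
card-split {suc K} P? Q? with P? Fin.zero | Q? Fin.zero
... | yes _ | yes _ = cong suc (card-split (P? ∘ Fin.suc) (Q? ∘ Fin.suc))
... | yes _ | no  _ = trans (cong suc (card-split (P? ∘ Fin.suc) (Q? ∘ Fin.suc))) (sym (+-suc _ _))
... | no  _ | _     = card-split (P? ∘ Fin.suc) (Q? ∘ Fin.suc)

card-pos : (P? : Decidable P) (i : Fin K) → P i → 0 < card P?
card-pos {suc K} P? i p with P? Fin.zero | i
... | yes _  | _        = s≤s z≤n
... | no ¬p0 | Fin.zero = contradiction p ¬p0
... | no _   | Fin.suc i = card-pos (P? ∘ Fin.suc) i p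

card-witness : (P? : Decidable P) → 0 < card P? → ∃ P
card-witness {suc K} P? pos with P? Fin.zero
... | yes p = Fin.zero , p
... | no _  = let i , p = card-witness (P? ∘ Fin.suc) pos in Fin.suc i , p

card-none : (P? : Decidable P) → (∀ i → ¬ P i) → card P? ≡ 0
card-none P? ¬P = n≤0⇒n≡0 (≮⇒≥ λ pos → let i , p = card-witness P? pos in ¬P i p)

card-< : ∀ {h} → h ≤ K → card {K} (λ i → toℕ i <? h) ≡ h
card-< {K} {zero}  _         = card-none {K} _ λ _ ()
card-< {suc K} {suc h} (s≤s h≤K) = cong suc (trans
  (card-cong {K} (λ i → suc (toℕ i) <? suc h) (λ i → toℕ i <? h) (λ _ → s≤s⁻¹) (λ _ → s≤s)) (card-< h≤K))

card-interval : ∀ {lo hi} → lo ≤ hi → hi ≤ K →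
                card {K} (λ i → (lo ≤? toℕ i) ×-dec (toℕ i <? hi)) ≡ hi ∸ lo
card-interval {K} {lo} {hi} lo≤hi hi≤K = begin
  card lo≤i<hi
    ≡⟨ card-cong lo≤i<hi (<hi ∩? ∁? <lo) (λ _ (p , q) → q , ≤⇒≯ p) (λ _ (q , p) → ≮⇒≥ p , q) ⟩
  card (<hi ∩? ∁? <lo)                               ≡⟨ sym (m+n∸m≡n (card (<hi ∩? <lo)) _) ⟩
  card (<hi ∩? <lo) + card (<hi ∩? ∁? <lo) ∸ card (<hi ∩? <lo)
    ≡⟨ cong₂ _∸_ (sym (card-split <hi <lo)) below-lo ⟩
  card <hi ∸ lo                                      ≡⟨ cong (_∸ lo) (card-< hi≤K) ⟩
  hi ∸ lo                                            ∎
  where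
  open ≡-Reasoning
  lo≤i<hi : Decidable λ (i : Fin K) → lo ≤ toℕ i × toℕ i < hi
  lo≤i<hi i = (lo ≤? toℕ i) ×-dec (toℕ i <? hi)
  <hi : Decidable λ (i : Fin K) → toℕ i < hi
  <lo : Decidable λ (i : Fin K) → toℕ i < lo
  <hi i = toℕ i <? hi
  <lo i = toℕ i <? lo
  below-lo : card (<hi ∩? <lo) ≡ lo
  below-lo = trans (card-cong (<hi ∩? <lo) <lo (λ _ → proj₂) (λ _ p → <-≤-trans p lo≤hi , p))
                   (card-< (≤-trans lo≤hi hi≤K))

card-mono-< : (P? : Decidable P) (Q? : Decidable Q) → (∀ i → P i → Q i) →
              ∀ i → Q i → ¬ P i → card P? < card Q?
card-mono-< P? Q? P⊆Q i q ¬p = begin-strict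
  card P?                               ≡⟨ card-cong P? (Q? ∩? P?) (λ j p → P⊆Q j p , p) (λ _ → proj₂) ⟩
  card (Q? ∩? P?)                       <⟨ m<m+n _ (card-pos (Q? ∩? ∁? P?) i (q , ¬p)) ⟩
  card (Q? ∩? P?) + card (Q? ∩? ∁? P?)  ≡⟨ card-split Q? P? ⟨
  card Q?                               ∎
  where open ≤-Reasoning

prefixSum : ∀ {n} → Vec ℕ n → ℕ → ℕ
prefixSum []      t       = 0
prefixSum (x ∷ s) zero    = 0
prefixSum (x ∷ s) (suc t) = x + prefixSum s t

prefixSum-zero : ∀ {n} (s : Vec ℕ n) → prefixSum s 0 ≡ 0
prefixSum-zero []      = refl
prefixSum-zero (x ∷ s) = refl

prefixSum-suc : ∀ {n} (s : Vec ℕ n) (j : Fin n) →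
                prefixSum s (suc (toℕ j)) ≡ prefixSum s (toℕ j) + lookup s j
prefixSum-suc (x ∷ s) Fin.zero    = trans (cong (x +_) (prefixSum-zero s)) (+-comm x 0)
prefixSum-suc (x ∷ s) (Fin.suc j) = trans (cong (x +_) (prefixSum-suc s j)) (sym (+-assoc x _ _))

prefixSum-total : ∀ {n} (s : Vec ℕ n) → prefixSum s n ≡ sum s
prefixSum-total []      = refl
prefixSum-total (x ∷ s) = cong (x +_) (prefixSum-total s)

prefixSum-mono : ∀ {n} (s : Vec ℕ n) {t t'} → t ≤ t' → prefixSum s t ≤ prefixSum s t'
prefixSum-mono []      _ = z≤n
prefixSum-mono (x ∷ s) {zero}  _ = z≤n
prefixSum-mono (x ∷ s) {suc t} {suc t'} (s≤s t≤t') = +-monoʳ-≤ x (prefixSum-mono s t≤t')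

prefixSum≤sum : ∀ {n} (s : Vec ℕ n) {t} → t ≤ n → prefixSum s t ≤ sum s
prefixSum≤sum s {t} t≤n = subst (prefixSum s t ≤_) (prefixSum-total s) (prefixSum-mono s t≤n)

m<n+o⇒m∸n<o′ : ∀ {m n o} → n ≤ m → m < n + o → m ∸ n < o
m<n+o⇒m∸n<o′ {m} {n} {o} n≤m m<n+o = subst (m ∸ n <_) (m+n∸m≡n n o) (∸-monoˡ-< m<n+o n≤m)

-- Cutting 0, 1, …, sum s - 1 into consecutive blocks of lengths s₀, s₁, …,
-- block s k is the block containing k; positions past the end go to the last block.
block : ∀ {m} → Vec ℕ (suc m) → ℕ → Fin (suc m)
block {zero}  (x ∷ []) k = Fin.zero
block {suc m} (x ∷ s)  k with k <? x
... | yes _ = Fin.zero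
... | no  _ = Fin.suc (block s (k ∸ x))

block-lower : ∀ {m} (s : Vec ℕ (suc m)) k → prefixSum s (toℕ (block s k)) ≤ k
block-lower {zero}  (x ∷ []) k = z≤n
block-lower {suc m} (x ∷ s)  k with k <? x
... | yes _   = z≤n
... | no  k≮x = begin
  x + prefixSum s (toℕ (block s (k ∸ x))) ≤⟨ +-monoʳ-≤ x (block-lower s (k ∸ x)) ⟩
  x + (k ∸ x)                             ≡⟨ m+[n∸m]≡n (≮⇒≥ k≮x) ⟩
  k                                       ∎
  where open ≤-Reasoning

block-upper : ∀ {m} (s : Vec ℕ (suc m)) k → k < sum s → k < prefixSum s (suc (toℕ (block s k)))
block-upper {zero}  (x ∷ []) k k<x = k<x
block-upper {suc m} (x ∷ s)  k k<sum with k <? x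
... | yes k<x = ≤-trans k<x (m≤m+n x _)
... | no  k≮x = begin-strict
  k                                             ≡⟨ m+[n∸m]≡n (≮⇒≥ k≮x) ⟨
  x + (k ∸ x)                                   <⟨ +-monoʳ-< x (block-upper s (k ∸ x) k∸x<sum) ⟩
  x + prefixSum s (suc (toℕ (block s (k ∸ x)))) ∎
  where
  open ≤-Reasoning
  k∸x<sum : k ∸ x < sum s
  k∸x<sum = m<n+o⇒m∸n<o′ (≮⇒≥ k≮x) k<sum

block-mono : ∀ {m} (s : Vec ℕ (suc m)) {k k'} → k ≤ k' → block s k Fin.≤ block s k'
block-mono {zero}  (x ∷ []) _ = z≤n
block-mono {suc m} (x ∷ s) {k} {k'} k≤k' with k <? x | k' <? x
... | yes _   | _        = z≤n
... | no  k≮x | yes k'<x = contradiction (≤-<-trans k≤k' k'<x) k≮x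
... | no  _   | no  _    = s≤s (block-mono s (∸-monoˡ-≤ x k≤k'))

block-unique : ∀ {m} (s : Vec ℕ (suc m)) k (j : Fin (suc m)) →
               prefixSum s (toℕ j) ≤ k → k < prefixSum s (suc (toℕ j)) → block s k ≡ j
block-unique {zero}  (x ∷ []) k Fin.zero _ _ = refl
block-unique {suc m} (x ∷ s)  k Fin.zero _ k<x with k <? x
... | yes _   = refl
... | no  k≮x = contradiction (subst (k <_) (trans (cong (x +_) (prefixSum-zero s)) (+-identityʳ x)) k<x) k≮x
block-unique {suc m} (x ∷ s)  k (Fin.suc j) lo hi with k <? x
... | yes k<x = contradiction (≤-<-trans (≤-trans (m≤m+n x _) lo) k<x) (<-irrefl refl)
... | no  k≮x = cong Fin.suc (block-unique s (k ∸ x) j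
                  (subst (_≤ k ∸ x) (m+n∸m≡n x _) (∸-monoˡ-≤ x lo)) (m<n+o⇒m∸n<o′ (≮⇒≥ k≮x) hi))

block-prefixSum : ∀ {m} (s : Vec ℕ (suc m)) (j : Fin (suc m)) → 0 < lookup s j →
                  block s (prefixSum s (toℕ j)) ≡ j
block-prefixSum s j pos = block-unique s _ j ≤-refl
  (subst (prefixSum s (toℕ j) <_) (sym (prefixSum-suc s j))
         (subst (_< prefixSum s (toℕ j) + lookup s j) (+-identityʳ _) (+-monoʳ-< _ pos)))

card-block : ∀ {m} (s : Vec ℕ (suc m)) (j : Fin (suc m)) →
             card {sum s} (λ k → block s (toℕ k) ≟ᶠ j) ≡ lookup s j
card-block s j = begin
  card {sum s} (λ k → block s (toℕ k) ≟ᶠ j)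
    ≡⟨ card-cong {sum s} (λ k → block s (toℕ k) ≟ᶠ j) in-block
                 (λ k → in-block⁺ (toℕ k) (toℕ<n k)) in-block⁻ ⟩
  card in-block
    ≡⟨ card-interval (prefixSum-mono s (n≤1+n _)) (prefixSum≤sum s (toℕ<n j)) ⟩
  prefixSum s (suc (toℕ j)) ∸ prefixSum s (toℕ j)
    ≡⟨ cong (_∸ prefixSum s (toℕ j)) (prefixSum-suc s j) ⟩
  prefixSum s (toℕ j) + lookup s j ∸ prefixSum s (toℕ j)
    ≡⟨ m+n∸m≡n (prefixSum s (toℕ j)) _ ⟩
  lookup s j ∎
  where
  open ≡-Reasoning
  in-block : Decidable λ (k : Fin (sum s)) → prefixSum s (toℕ j) ≤ toℕ k × toℕ k < prefixSum s (suc (toℕ j))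
  in-block k = (prefixSum s (toℕ j) ≤? toℕ k) ×-dec (toℕ k <? prefixSum s (suc (toℕ j)))
  in-block⁺ : ∀ k → k < sum s → block s k ≡ j → prefixSum s (toℕ j) ≤ k × k < prefixSum s (suc (toℕ j))
  in-block⁺ k k<sum refl = block-lower s k , block-upper s k k<sum
  in-block⁻ : ∀ k → prefixSum s (toℕ j) ≤ toℕ k × toℕ k < prefixSum s (suc (toℕ j)) → block s (toℕ k) ≡ j
  in-block⁻ k (lo , hi) = block-unique s (toℕ k) j lo hi

_≟ₛ_ : DecidableEquality Step
E ≟ₛ E = yes refl
E ≟ₛ N = no λ ()
N ≟ₛ E = no λ ()
N ≟ₛ N = yes refl

earlier? : ∀ {M} (u : Vec Step M) s x → Decidable λ y → lookup u y ≡ s × toℕ y < x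
earlier? u s x y = (lookup u y ≟ₛ s) ×-dec (toℕ y <? x)

rank : ∀ {M} → Vec Step M → Step → ℕ → ℕ
rank u s x = card (earlier? u s x)

occurrences : ∀ {M} → Vec Step M → Step → ℕ
occurrences {M} u s = rank u s M

rank-zero : ∀ {M} (u : Vec Step M) s → rank u s 0 ≡ 0
rank-zero u s = card-none (earlier? u s 0) λ { _ (_ , ()) }

rank-tail : ∀ {M} (u : Vec Step M) t s x → card (earlier? (t ∷ u) s (suc x) ∘ Fin.suc) ≡ rank u s x
rank-tail u t s x = card-cong (earlier? (t ∷ u) s (suc x) ∘ Fin.suc) (earlier? u s x)
  (λ _ (p , q) → p , s≤s⁻¹ q) (λ _ (p , q) → p , s≤s q)

rank-here : ∀ {M} (u : Vec Step M) {t s} x → t ≡ s → rank (t ∷ u) s (suc x) ≡ suc (rank u s x)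
rank-here u {t} {s} x t≡s = trans (card-here (earlier? (t ∷ u) s (suc x)) (t≡s , z<s)) (cong suc (rank-tail u t s x))

rank-there : ∀ {M} (u : Vec Step M) {t s} x → t ≢ s → rank (t ∷ u) s (suc x) ≡ rank u s x
rank-there u {t} {s} x t≢s = trans (card-there (earlier? (t ∷ u) s (suc x)) (t≢s ∘ proj₁)) (rank-tail u t s x)

rank-mono : ∀ {M} (u : Vec Step M) s {x x'} → x ≤ x' → rank u s x ≤ rank u s x'
rank-mono u s {x} {x'} x≤x' = card-mono (earlier? u s x) (earlier? u s x') λ _ (p , q) → p , <-≤-trans q x≤x'

rank-< : ∀ {M} (u : Vec Step M) {s} (y : Fin M) {x} → toℕ y < x → lookup u y ≡ s →
         rank u s (toℕ y) < rank u s x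
rank-< u {s} y {x} y<x uy≡s = card-mono-< (earlier? u s (toℕ y)) (earlier? u s x)
  (λ _ (p , q) → p , <-trans q y<x) y (uy≡s , y<x) λ (_ , y<y) → <-irrefl refl y<y

rank-hit : ∀ {M} (u : Vec Step M) s x k → k < rank u s x →
           ∃ λ y → toℕ y < x × lookup u y ≡ s × rank u s (toℕ y) ≡ k
rank-hit []      s x       k ()
rank-hit (t ∷ u) s zero    k k<0 = contradiction (subst (k <_) (rank-zero (t ∷ u) s) k<0) λ ()
rank-hit (t ∷ u) s (suc x) k k<r = hit-∷ (t ≟ₛ s) k k<r
  where
  hit-∷ : Dec (t ≡ s) → ∀ k → k < rank (t ∷ u) s (suc x) →
          ∃ λ y → toℕ y < suc x × lookup (t ∷ u) y ≡ s × rank (t ∷ u) s (toℕ y) ≡ k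
  hit-∷ (no t≢s) k k<r =
    let y , y<x , uy , ry = rank-hit u s x k (subst (k <_) (rank-there u x t≢s) k<r)
    in Fin.suc y , s≤s y<x , uy , trans (rank-there u (toℕ y) t≢s) ry
  hit-∷ (yes t≡s) zero _ = Fin.zero , z<s , t≡s , rank-zero (t ∷ u) s
  hit-∷ (yes t≡s) (suc k) k<r =
    let y , y<x , uy , ry = rank-hit u s x k (s≤s⁻¹ (subst (suc k <_) (rank-here u x t≡s) k<r))
    in Fin.suc y , s≤s y<x , uy , trans (rank-here u (toℕ y) t≡s) (cong suc ry)

heightAfter-rank : ∀ {M} (u : Vec Step M) (x : Fin M) → lookup u x ≡ E →
                   heightAfter (toList u) (rank u E (toℕ x)) ≡ rank u N (toℕ x)
heightAfter-rank (E ∷ u) Fin.zero    refl =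
  trans (cong (heightAfter (E List.∷ toList u)) (rank-zero (E ∷ u) E)) (sym (rank-zero (E ∷ u) N))
heightAfter-rank (E ∷ u) (Fin.suc x) ux≡E = begin
  heightAfter (E List.∷ toList u) (rank (E ∷ u) E (suc (toℕ x)))
    ≡⟨ cong (heightAfter (E List.∷ toList u)) (rank-here u {E} (toℕ x) refl) ⟩
  heightAfter (toList u) (rank u E (toℕ x))                      ≡⟨ heightAfter-rank u x ux≡E ⟩
  rank u N (toℕ x)                                               ≡⟨ rank-there u {E} (toℕ x) (λ ()) ⟨
  rank (E ∷ u) N (suc (toℕ x))                                   ∎
  where open ≡-Reasoning
heightAfter-rank (N ∷ u) (Fin.suc x) ux≡E = begin
  heightAfter (N List.∷ toList u) (rank (N ∷ u) E (suc (toℕ x)))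
    ≡⟨ cong (heightAfter (N List.∷ toList u)) (rank-there u {N} (toℕ x) (λ ())) ⟩
  suc (heightAfter (toList u) (rank u E (toℕ x)))                ≡⟨ cong suc (heightAfter-rank u x ux≡E) ⟩
  suc (rank u N (toℕ x))                                         ≡⟨ rank-here u {N} (toℕ x) refl ⟨
  rank (N ∷ u) N (suc (toℕ x))                                   ∎
  where open ≡-Reasoning

length-filter-isE : ∀ {M} (u : Vec Step M) → List.length (List.filter isE? (toList u)) ≡ occurrences u E
length-filter-isE []      = refl
length-filter-isE (E ∷ u) = trans (cong suc (length-filter-isE u)) (sym (rank-here u {E} _ refl))
length-filter-isE (N ∷ u) = trans (length-filter-isE u) (sym (rank-there u {N} _ λ ()))

length-filter-isN : ∀ {M} (u : Vec Step M) → List.length (List.filter isN? (toList u)) ≡ occurrences u N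
length-filter-isN []      = refl
length-filter-isN (N ∷ u) = trans (cong suc (length-filter-isN u)) (sym (rank-here u {N} _ refl))
length-filter-isN (E ∷ u) = trans (length-filter-isN u) (sym (rank-there u {E} _ λ ()))

length≡#E+#N : ∀ w → List.length w ≡ List.length (List.filter isE? w) + List.length (List.filter isN? w)
length≡#E+#N List.[]       = refl
length≡#E+#N (E List.∷ w) = cong suc (length≡#E+#N w)
length≡#E+#N (N List.∷ w) = trans (cong suc (length≡#E+#N w)) (sym (+-suc _ _))

-- Numbering the occurrences of s in u by their ranks identifies them with Fin (occurrences u s).
card-by-rank : ∀ {M} (u : Vec Step M) s {Q : Pred ℕ 0ℓ} (Q? : Decidable Q) →
               card (λ y → (lookup u y ≟ₛ s) ×-dec Q? (rank u s (toℕ y))) ≡ card {occurrences u s} (Q? ∘ toℕ)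
card-by-rank []      s Q? = refl
card-by-rank {suc M} (t ∷ u) s {Q} Q? = by-head (t ≟ₛ s)
  where
  open ≡-Reasoning
  L? : Decidable λ (y : Fin (suc M)) → lookup (t ∷ u) y ≡ s × Q (rank (t ∷ u) s (toℕ y))
  L? y = (lookup (t ∷ u) y ≟ₛ s) ×-dec Q? (rank (t ∷ u) s (toℕ y))
  Lᵤ? : ∀ {Q′ : Pred ℕ 0ℓ} → Decidable Q′ →
        Decidable λ (y : Fin M) → lookup u y ≡ s × Q′ (rank u s (toℕ y))
  Lᵤ? Q′? y = (lookup u y ≟ₛ s) ×-dec Q′? (rank u s (toℕ y))
  tail : (g : ℕ → ℕ) → (∀ r → rank (t ∷ u) s (suc r) ≡ g (rank u s r)) →
         card (L? ∘ Fin.suc) ≡ card {occurrences u s} (Q? ∘ g ∘ toℕ)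
  tail g rank-suc = trans
    (card-cong (L? ∘ Fin.suc) (Lᵤ? (Q? ∘ g))
      (λ y (p , q) → p , subst Q (rank-suc (toℕ y)) q) (λ y (p , q) → p , subst Q (sym (rank-suc (toℕ y))) q))
    (card-by-rank u s (Q? ∘ g))
  by-head : Dec (t ≡ s) → card L? ≡ card {occurrences (t ∷ u) s} (Q? ∘ toℕ)
  by-head (no t≢s) = begin
    card L?                                 ≡⟨ card-there L? (t≢s ∘ proj₁) ⟩
    card (L? ∘ Fin.suc)                     ≡⟨ tail (λ r → r) (λ r → rank-there u r t≢s) ⟩
    card {occurrences u s} (Q? ∘ toℕ)        ≡⟨ cong (λ K → card {K} (Q? ∘ toℕ)) (rank-there u M t≢s) ⟨
    card {occurrences (t ∷ u) s} (Q? ∘ toℕ) ∎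
  by-head (yes t≡s) = begin
    card L?                                                        ≡⟨ card-suc L? ⟩
    card {1} (λ _ → L? Fin.zero) + card (L? ∘ Fin.suc)             ≡⟨ cong₂ _+_ head (tail suc (λ r → rank-here u r t≡s)) ⟩
    card {1} (λ _ → Q? 0) + card {occurrences u s} (Q? ∘ suc ∘ toℕ) ≡⟨ card-suc {occurrences u s} (Q? ∘ toℕ) ⟨
    card {suc (occurrences u s)} (Q? ∘ toℕ)                         ≡⟨ cong (λ K → card {K} (Q? ∘ toℕ)) (rank-here u M t≡s) ⟨
    card {occurrences (t ∷ u) s} (Q? ∘ toℕ)                         ∎
    where
    head : card {1} (λ _ → L? Fin.zero) ≡ card {1} (λ _ → Q? 0)
    head = card-cong {1} (λ _ → L? Fin.zero) (λ _ → Q? 0)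
      (λ _ (_ , q) → subst Q (rank-zero (t ∷ u) s) q) (λ _ q → t≡s , subst Q (sym (rank-zero (t ∷ u) s)) q)

heightAfter-E^< : ∀ x w i → i < x → heightAfter (replicate x E ++ w) i ≡ 0
heightAfter-E^< (suc x) w zero    _         = refl
heightAfter-E^< (suc x) w (suc i) (s≤s i<x) = heightAfter-E^< x w i i<x

heightAfter-E^≥ : ∀ x w i → x ≤ i → heightAfter (replicate x E ++ w) i ≡ heightAfter w (i ∸ x)
heightAfter-E^≥ zero    w i       _         = refl
heightAfter-E^≥ (suc x) w (suc i) (s≤s x≤i) = heightAfter-E^≥ x w i x≤i

heightAfter-N^ : ∀ y w i → heightAfter (replicate y N ++ w) i ≡ y + heightAfter w i
heightAfter-N^ zero    w i = refl
heightAfter-N^ (suc y) w i = cong suc (heightAfter-N^ y w i)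

heightAfter-Pmax : ∀ {m} (a b : Vec ℕ (suc m)) i → i < sum a →
                   heightAfter (Pmax a b) i ≡ prefixSum b (toℕ (block a i))
heightAfter-Pmax {zero}  (x ∷ []) (y ∷ []) i i<x = heightAfter-E^< x _ i (subst (i <_) (+-identityʳ x) i<x)
heightAfter-Pmax {suc m} (x ∷ a)  (y ∷ b)  i i<sum with i <? x
... | yes i<x = heightAfter-E^< x _ i i<x
... | no  i≮x = begin
  heightAfter (Pmax (x ∷ a) (y ∷ b)) i                ≡⟨ heightAfter-E^≥ x _ i (≮⇒≥ i≮x) ⟩
  heightAfter (replicate y N ++ Pmax a b) (i ∸ x)      ≡⟨ heightAfter-N^ y _ (i ∸ x) ⟩
  y + heightAfter (Pmax a b) (i ∸ x)                   ≡⟨ cong (y +_) (heightAfter-Pmax a b (i ∸ x) i∸x<sum) ⟩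
  y + prefixSum b (toℕ (block a (i ∸ x)))              ∎
  where
  open ≡-Reasoning
  i∸x<sum : i ∸ x < sum a
  i∸x<sum = m<n+o⇒m∸n<o′ (≮⇒≥ i≮x) i<sum

count≡card : ∀ {A : Set} {M} {P : Pred A 0ℓ} (P? : Decidable P) (v : Vec A M) →
             Vec.count P? v ≡ card (P? ∘ lookup v)
count≡card P? []      = refl
count≡card P? (x ∷ v) with P? x
... | yes _ = cong suc (count≡card P? v)
... | no  _ = count≡card P? v

rowOf : Step → Fin 2
rowOf E = Fin.zero
rowOf N = Fin.suc Fin.zero

stepOf : Fin 2 → Step
stepOf Fin.zero    = E
stepOf (Fin.suc _) = N

rowOf-injective : ∀ {s t} → rowOf s ≡ rowOf t → s ≡ t
rowOf-injective {E} {E} _ = refl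
rowOf-injective {N} {N} _ = refl

rowOf-stepOf : ∀ r → rowOf (stepOf r) ≡ r
rowOf-stepOf Fin.zero           = refl
rowOf-stepOf (Fin.suc Fin.zero) = refl

stepOf-rowOf : ∀ s → stepOf (rowOf s) ≡ s
stepOf-rowOf E = refl
stepOf-rowOf N = refl

toList-injective′ : ∀ {A : Set} {M} {xs ys : Vec A M} → toList xs ≡ toList ys → xs ≡ ys
toList-injective′ {xs = xs} {ys} eq = trans (sym (cast-is-id refl xs)) (toList-injective refl xs ys eq)

rowWord : ∀ {n M} → Vec (Cell n) M → Vec Step M
rowWord = Vec.map (stepOf ∘ proj₁)

module TwoRowShape {m : ℕ} (a b : Vec ℕ (suc m)) where

  lengths : Step → Vec ℕ (suc m)
  lengths E = a
  lengths N = b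

  ρ-rowOf : ∀ s j → ρ a b (rowOf s , j) ≡ lookup (lengths s) j
  ρ-rowOf E j = refl
  ρ-rowOf N j = refl

  cellOf : ∀ {M} → Vec Step M → Fin M → Cell (suc m)
  cellOf u x = rowOf (lookup u x) , block (lengths (lookup u x)) (rank u (lookup u x) (toℕ x))

  decode : ∀ {M} → Vec Step M → Vec (Cell (suc m)) M
  decode u = tabulate (cellOf u)

  rowWord-decode : ∀ {M} (u : Vec Step M) → rowWord (decode u) ≡ u
  rowWord-decode u = begin
    Vec.map (stepOf ∘ proj₁) (tabulate (cellOf u)) ≡⟨ tabulate-∘ (stepOf ∘ proj₁) (cellOf u) ⟨
    tabulate (stepOf ∘ proj₁ ∘ cellOf u)           ≡⟨ tabulate-cong (λ x → stepOf-rowOf (lookup u x)) ⟩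
    tabulate (lookup u)                            ≡⟨ tabulate∘lookup u ⟩
    u                                              ∎
    where open ≡-Reasoning

  module Filling (lengths⁺ : ∀ s j → 0 < lookup (lengths s) j)
                 {M} (v : Vec (Cell (suc m)) M) (svt : IsSVT a b v) where

    u : Vec Step M
    u = rowWord v

    letter≡stepOf-row : ∀ y → lookup u y ≡ stepOf (proj₁ (lookup v y))
    letter≡stepOf-row y = lookup-map y (stepOf ∘ proj₁) v

    in-row : ∀ {y s} → lookup u y ≡ s → lookup v y ≡ (rowOf s , proj₂ (lookup v y))
    in-row {y} {s} uy≡s =
      cong (_, proj₂ (lookup v y)) (trans (sym (rowOf-stepOf _)) (cong rowOf (trans (sym (letter≡stepOf-row y)) uy≡s)))

    letter : ∀ {y s j} → lookup v y ≡ (rowOf s , j) → lookup u y ≡ s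
    letter {y} {s} vy≡ = trans (letter≡stepOf-row y) (trans (cong (stepOf ∘ proj₁) vy≡) (stepOf-rowOf s))

    occupied : ∀ c → ∃ λ x → lookup v x ≡ c
    occupied c = card-witness (λ x → lookup v x ≟c c)
      (subst (0 <_) (trans (sym (proj₁ svt c)) (count≡card (_≟c c) v)) (ρ⁺ c))
      where
      ρ⁺ : ∀ c → 0 < ρ a b c
      ρ⁺ (Fin.zero , j)           = lengths⁺ E j
      ρ⁺ (Fin.suc Fin.zero , j)   = lengths⁺ N j

    increasing : ∀ {x y c d} → lookup v x ≡ c → lookup v y ≡ d → Succ c d → toℕ x < toℕ y
    increasing {x} {y} vx≡c vy≡d c→d = proj₂ svt x y (subst₂ Succ (sym vx≡c) (sym vy≡d) c→d)

    row-increasing : ∀ {x y r j j'} → lookup v x ≡ (r , j) → lookup v y ≡ (r , j') →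
                     toℕ j < toℕ j' → toℕ x < toℕ y
    row-increasing {x} {y} {r} {j} {j'} vx vy j<j' = by-gap (toℕ j' ∸ suc (toℕ j)) j' y vy
      (trans (sym (m∸n+n≡m j<j')) (+-suc _ (toℕ j)))
      where
      by-gap : ∀ d j' y → lookup v y ≡ (r , j') → toℕ j' ≡ suc (d + toℕ j) → toℕ x < toℕ y
      by-gap zero    j' y vy j'≡ = increasing vx vy (right r j j' j'≡)
      by-gap (suc d) j' y vy j'≡ =
        <-trans (by-gap d j″ z vz (toℕ-fromℕ< j″<)) (increasing vz vy (right r j″ j' j'≡′))
        where
        j″< : suc (d + toℕ j) < suc m
        j″< = <-trans (n<1+n _) (subst (_< suc m) j'≡ (toℕ<n j'))
        j″ : Fin (suc m)
        j″ = Fin.fromℕ< j″<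
        z : Fin M
        z = proj₁ (occupied (r , j″))
        vz : lookup v z ≡ (r , j″)
        vz = proj₂ (occupied (r , j″))
        j'≡′ : toℕ j' ≡ suc (toℕ j″)
        j'≡′ = trans j'≡ (cong suc (sym (toℕ-fromℕ< j″<)))

    card-cell : ∀ s j → card (λ y → lookup v y ≟c (rowOf s , j)) ≡ lookup (lengths s) j
    card-cell s j = trans (sym (count≡card (_≟c (rowOf s , j)) v)) (trans (proj₁ svt (rowOf s , j)) (ρ-rowOf s j))

    row-prefix? : ∀ s t → Decidable λ y → lookup u y ≡ s × toℕ (proj₂ (lookup v y)) < t
    row-prefix? s t y = (lookup u y ≟ₛ s) ×-dec (toℕ (proj₂ (lookup v y)) <? t)

    card-row-prefix : ∀ s t → t ≤ suc m → card (row-prefix? s t) ≡ prefixSum (lengths s) t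
    card-row-prefix s zero    _ = trans (card-none (row-prefix? s 0) λ { _ (_ , ()) }) (sym (prefixSum-zero (lengths s)))
    card-row-prefix s (suc t) t<n = begin
      card (row-prefix? s (suc t))
        ≡⟨ card-split (row-prefix? s (suc t)) column<t ⟩
      card (row-prefix? s (suc t) ∩? column<t) + card (row-prefix? s (suc t) ∩? ∁? column<t)
        ≡⟨ cong₂ _+_ columns<t column-t ⟩
      prefixSum (lengths s) t + lookup (lengths s) j
        ≡⟨ cong (λ t → prefixSum (lengths s) t + lookup (lengths s) j) toℕj≡t ⟨
      prefixSum (lengths s) (toℕ j) + lookup (lengths s) j
        ≡⟨ prefixSum-suc (lengths s) j ⟨
      prefixSum (lengths s) (suc (toℕ j))
        ≡⟨ cong (prefixSum (lengths s) ∘ suc) toℕj≡t ⟩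
      prefixSum (lengths s) (suc t) ∎
      where
      open ≡-Reasoning
      j : Fin (suc m)
      j = Fin.fromℕ< t<n
      toℕj≡t : toℕ j ≡ t
      toℕj≡t = toℕ-fromℕ< t<n
      column<t : Decidable λ y → toℕ (proj₂ (lookup v y)) < t
      column<t y = toℕ (proj₂ (lookup v y)) <? t
      to-cell : ∀ y → (lookup u y ≡ s × toℕ (proj₂ (lookup v y)) < suc t) × ¬ toℕ (proj₂ (lookup v y)) < t →
                lookup v y ≡ (rowOf s , j)
      to-cell y ((uy≡s , <suc) , ≮t) = trans (in-row uy≡s)
        (cong (rowOf s ,_) (toℕ-injective (trans (≤-antisym (s≤s⁻¹ <suc) (≮⇒≥ ≮t)) (sym toℕj≡t))))
      from-cell : ∀ y → lookup v y ≡ (rowOf s , j) →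
                  (lookup u y ≡ s × toℕ (proj₂ (lookup v y)) < suc t) × ¬ toℕ (proj₂ (lookup v y)) < t
      from-cell y vy≡ = (letter vy≡ , s≤s (≤-reflexive column≡t)) , λ <t → <-irrefl column≡t <t
        where
        column≡t : toℕ (proj₂ (lookup v y)) ≡ t
        column≡t = trans (cong (toℕ ∘ proj₂) vy≡) toℕj≡t
      columns<t : card (row-prefix? s (suc t) ∩? column<t) ≡ prefixSum (lengths s) t
      columns<t = trans
        (card-cong (row-prefix? s (suc t) ∩? column<t) (row-prefix? s t)
          (λ _ ((p , _) , q) → p , q) (λ _ (p , q) → (p , m<n⇒m<1+n q) , q))
        (card-row-prefix s t (<⇒≤ t<n))
      column-t : card (row-prefix? s (suc t) ∩? ∁? column<t) ≡ lookup (lengths s) j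
      column-t = trans
        (card-cong (row-prefix? s (suc t) ∩? ∁? column<t) (λ y → lookup v y ≟c (rowOf s , j)) to-cell from-cell)
        (card-cell s j)

    column-by-rank : ∀ {x s j} → lookup v x ≡ (rowOf s , j) → block (lengths s) (rank u s (toℕ x)) ≡ j
    column-by-rank {x} {s} {j} vx≡ = block-unique (lengths s) _ j lower upper
      where
      lower : prefixSum (lengths s) (toℕ j) ≤ rank u s (toℕ x)
      lower = subst (_≤ rank u s (toℕ x)) (card-row-prefix s (toℕ j) (<⇒≤ (toℕ<n j)))
        (card-mono (row-prefix? s (toℕ j)) (earlier? u s (toℕ x))
          λ y (uy≡s , <j) → uy≡s , row-increasing (in-row uy≡s) vx≡ <j)
      upper : rank u s (toℕ x) < prefixSum (lengths s) (suc (toℕ j))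
      upper = subst (rank u s (toℕ x) <_) (card-row-prefix s (suc (toℕ j)) (toℕ<n j))
        (card-mono-< (earlier? u s (toℕ x)) (row-prefix? s (suc (toℕ j)))
          (λ y (uy≡s , y<x) → uy≡s , s≤s (≮⇒≥ λ j< → <-asym y<x (row-increasing vx≡ (in-row uy≡s) j<)))
          x (letter vx≡ , s≤s (≤-reflexive (cong (toℕ ∘ proj₂) vx≡))) λ (_ , x<x) → <-irrefl refl x<x)

    cell-by-rank : ∀ {x s} → lookup u x ≡ s → lookup v x ≡ (rowOf s , block (lengths s) (rank u s (toℕ x)))
    cell-by-rank ux≡s = trans (in-row ux≡s) (cong (rowOf _ ,_) (sym (column-by-rank (in-row ux≡s))))

    decode-rowWord : decode u ≡ v
    decode-rowWord = trans (tabulate-cong λ x → sym (cell-by-rank refl)) (tabulate∘lookup v)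

    occurrences-rowWord : ∀ s → occurrences u s ≡ sum (lengths s)
    occurrences-rowWord s = begin
      occurrences u s                       ≡⟨ card-cong (earlier? u s M) (row-prefix? s (suc m))
                                                 (λ _ (p , _) → p , toℕ<n _) (λ y (p , _) → p , toℕ<n y) ⟩
      card (row-prefix? s (suc m))          ≡⟨ card-row-prefix s (suc m) ≤-refl ⟩
      prefixSum (lengths s) (suc m)         ≡⟨ prefixSum-total (lengths s) ⟩
      sum (lengths s)                       ∎
      where open ≡-Reasoning

    rowWord-below-Pmax : ∀ (i : Fin (sum a)) → heightAfter (toList u) (toℕ i) ≤ heightAfter (Pmax a b) (toℕ i)
    rowWord-below-Pmax i =
      below-at (rank-hit u E M (toℕ i) (subst (toℕ i <_) (sym (occurrences-rowWord E)) (toℕ<n i)))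
      where
      j : Fin (suc m)
      j = block a (toℕ i)
      below-at : (∃ λ x → toℕ x < M × lookup u x ≡ E × rank u E (toℕ x) ≡ toℕ i) →
                 heightAfter (toList u) (toℕ i) ≤ heightAfter (Pmax a b) (toℕ i)
      below-at (x , _ , ux≡E , rank-x) = begin
        heightAfter (toList u) (toℕ i)            ≡⟨ cong (heightAfter (toList u)) rank-x ⟨
        heightAfter (toList u) (rank u E (toℕ x)) ≡⟨ heightAfter-rank u x ux≡E ⟩
        rank u N (toℕ x)                          ≤⟨ ≮⇒≥ (λ > → no-N-before-x (rank-hit u N (toℕ x) _ >)) ⟩
        prefixSum b (toℕ j)                       ≡⟨ heightAfter-Pmax a b (toℕ i) (toℕ<n i) ⟨
        heightAfter (Pmax a b) (toℕ i)            ∎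
        where
        open ≤-Reasoning
        -- the first entry of cell (2, j) would precede the last entry of cell (1, j)
        no-N-before-x : ¬ ∃ λ y → toℕ y < toℕ x × lookup u y ≡ N × rank u N (toℕ y) ≡ prefixSum b (toℕ j)
        no-N-before-x (y , y<x , uy≡N , rank-y) = <-asym y<x (increasing vx vy (below j))
          where
          vx : lookup v x ≡ (Fin.zero , j)
          vx = trans (cell-by-rank ux≡E) (cong (λ k → Fin.zero , block a k) rank-x)
          vy : lookup v y ≡ (Fin.suc Fin.zero , j)
          vy = trans (cell-by-rank uy≡N) (cong (Fin.suc Fin.zero ,_)
                 (trans (cong (block b) rank-y) (block-prefixSum b j (lengths⁺ N j))))

  cellOf-≡ : ∀ {M} (u : Vec Step M) {x s} → lookup u x ≡ s →
             cellOf u x ≡ (rowOf s , block (lengths s) (rank u s (toℕ x)))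
  cellOf-≡ u {x} = cong λ t → rowOf t , block (lengths t) (rank u t (toℕ x))

  cellOf-inv : ∀ {M} (u : Vec Step M) {x s j} → cellOf u x ≡ (rowOf s , j) →
               lookup u x ≡ s × block (lengths s) (rank u s (toℕ x)) ≡ j
  cellOf-inv u {x} {s} {j} cell≡ =
    ux≡s , subst (λ t → block (lengths t) (rank u t (toℕ x)) ≡ j) ux≡s (,-injectiveʳ cell≡)
    where
    ux≡s : lookup u x ≡ s
    ux≡s = rowOf-injective (,-injectiveˡ cell≡)

  module BoundedWord {M} (u : Vec Step M) (occurrences-u : ∀ s → occurrences u s ≡ sum (lengths s))
              (under-Pmax : ∀ i → i < sum a → heightAfter (toList u) i ≤ heightAfter (Pmax a b) i) where

    card-decode-cell : ∀ s j → card (λ y → cellOf u y ≟c (rowOf s , j)) ≡ lookup (lengths s) j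
    card-decode-cell s j = begin
      card (λ y → cellOf u y ≟c (rowOf s , j))
        ≡⟨ card-cong (λ y → cellOf u y ≟c (rowOf s , j)) (λ y → (lookup u y ≟ₛ s) ×-dec column-j? (rank u s (toℕ y)))
                     (λ _ → cellOf-inv u)
                     (λ _ (uy≡s , column≡j) → trans (cellOf-≡ u uy≡s) (cong (rowOf s ,_) column≡j)) ⟩
      card (λ y → (lookup u y ≟ₛ s) ×-dec column-j? (rank u s (toℕ y)))
        ≡⟨ card-by-rank u s column-j? ⟩
      card {occurrences u s} (column-j? ∘ toℕ)
        ≡⟨ cong (λ K → card {K} (column-j? ∘ toℕ)) (occurrences-u s) ⟩
      card {sum (lengths s)} (column-j? ∘ toℕ)
        ≡⟨ card-block (lengths s) j ⟩
      lookup (lengths s) j ∎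
      where
      open ≡-Reasoning
      column-j? : Decidable λ k → block (lengths s) k ≡ j
      column-j? k = block (lengths s) k ≟ᶠ j

    decode-counts : ∀ c → Vec.count (_≟c c) (decode u) ≡ ρ a b c
    decode-counts c = trans (count≡card (_≟c c) (decode u))
      (trans (card-cong ((_≟c c) ∘ lookup (decode u)) (λ y → cellOf u y ≟c c)
               (λ y → trans (sym (lookup∘tabulate (cellOf u) y))) (λ y → trans (lookup∘tabulate (cellOf u) y)))
             (by-row c))
      where
      by-row : ∀ c → card (λ y → cellOf u y ≟c c) ≡ ρ a b c
      by-row (Fin.zero , j)         = card-decode-cell E j
      by-row (Fin.suc Fin.zero , j) = card-decode-cell N j

    decode-increasing : ∀ {x y c d} → Succ c d → cellOf u x ≡ c → cellOf u y ≡ d → toℕ x < toℕ y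
    decode-increasing {x} {y} (right _ j j' j'≡) refl cell-y = ≰⇒> λ y≤x → <-irrefl j'≡ (begin-strict
      toℕ j'                                          ≡⟨ cong toℕ column-y ⟨
      toℕ (block (lengths s) (rank u s (toℕ y)))      ≤⟨ block-mono (lengths s) (rank-mono u s y≤x) ⟩
      toℕ j                                           <⟨ n<1+n (toℕ j) ⟩
      suc (toℕ j)                                     ∎)
      where
      open ≤-Reasoning
      s : Step
      s = lookup u x
      column-y : block (lengths s) (rank u s (toℕ y)) ≡ j'
      column-y = proj₂ (cellOf-inv u cell-y)
    decode-increasing {x} {y} (below j) cell-x cell-y = ≤∧≢⇒< (≮⇒≥ y≮x) x≢y
      where
      ux≡E : lookup u x ≡ E
      ux≡E = proj₁ (cellOf-inv u cell-x)
      uy≡N : lookup u y ≡ N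
      uy≡N = proj₁ (cellOf-inv u cell-y)
      same-column : block a (rank u E (toℕ x)) ≡ block b (rank u N (toℕ y))
      same-column = trans (proj₂ (cellOf-inv u cell-x)) (sym (proj₂ (cellOf-inv u cell-y)))
      x≢y : toℕ x ≢ toℕ y
      x≢y x≡y with toℕ-injective x≡y
      ... | refl with trans (sym ux≡E) uy≡N
      ...   | ()
      -- y < x would put the path strictly above P_max on the strip of the E step x
      y≮x : ¬ toℕ y < toℕ x
      y≮x y<x = <-irrefl refl (begin-strict
        rank u N (toℕ x)                                ≡⟨ heightAfter-rank u x ux≡E ⟨
        heightAfter (toList u) i                        ≤⟨ under-Pmax i i<sum ⟩
        heightAfter (Pmax a b) i                        ≡⟨ heightAfter-Pmax a b i i<sum ⟩
        prefixSum b (toℕ (block a i))                   ≡⟨ cong (prefixSum b ∘ toℕ) same-column ⟩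
        prefixSum b (toℕ (block b (rank u N (toℕ y)))) ≤⟨ block-lower b _ ⟩
        rank u N (toℕ y)                                <⟨ rank-< u y y<x uy≡N ⟩
        rank u N (toℕ x)                                ∎)
        where
        open ≤-Reasoning
        i : ℕ
        i = rank u E (toℕ x)
        i<sum : i < sum a
        i<sum = subst (i <_) (occurrences-u E) (rank-< u x (toℕ<n x) ux≡E)

    decode-isSVT : IsSVT a b (decode u)
    decode-isSVT = decode-counts , λ x y x→y →
      decode-increasing x→y (sym (lookup∘tabulate (cellOf u) x)) (sym (lookup∘tabulate (cellOf u) y))

  wordOf : Path (sum a) (sum b) → Vec Step (sum a + sum b)
  wordOf (w , #E , #N) = Vec.cast (trans (length≡#E+#N w) (cong₂ _+_ #E #N)) (Vec.fromList w)

  toList-wordOf : ∀ P → toList (wordOf P) ≡ proj₁ P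
  toList-wordOf (w , _) = trans (toList-cast _ (Vec.fromList w)) (toList∘fromList w)

  wordOf-unique : ∀ P {u} → proj₁ P ≡ toList u → wordOf P ≡ u
  wordOf-unique P P≡u = toList-injective′ (trans (toList-wordOf P) P≡u)

  occurrences-wordOf : ∀ P s → occurrences (wordOf P) s ≡ sum (lengths s)
  occurrences-wordOf P@(_ , #E , _) E =
    trans (sym (length-filter-isE (wordOf P))) (trans (cong (List.length ∘ List.filter isE?) (toList-wordOf P)) #E)
  occurrences-wordOf P@(_ , _ , #N) N =
    trans (sym (length-filter-isN (wordOf P))) (trans (cong (List.length ∘ List.filter isN?) (toList-wordOf P)) #N)

  fromPath : I a b → SVT a b
  fromPath (P , P≼Pmax) = decode (wordOf P) , BoundedWord.decode-isSVT (wordOf P) (occurrences-wordOf P) under-Pmax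
    where
    under-Pmax : ∀ i → i < sum a → heightAfter (toList (wordOf P)) i ≤ heightAfter (Pmax a b) i
    under-Pmax i i<sum = subst₂ (λ w i → heightAfter w i ≤ heightAfter (Pmax a b) i)
      (sym (toList-wordOf P)) (toℕ-fromℕ< i<sum) (P≼Pmax (Fin.fromℕ< i<sum))

  module _ (lengths⁺ : ∀ s j → 0 < lookup (lengths s) j) where

    toPath : SVT a b → I a b
    toPath (v , svt) = (toList u , trans (length-filter-isE u) (occurrences-rowWord E)
                                 , trans (length-filter-isN u) (occurrences-rowWord N)) , rowWord-below-Pmax
      where open Filling lengths⁺ v svt

    SVT↔I : Inverse (SVT-setoid a b) (I-setoid a b)
    SVT↔I = record
      { to        = toPath
      ; from      = fromPath
      ; to-cong   = cong (toList ∘ rowWord)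
      ; from-cong = λ {P} {Q} P≡Q → cong decode (wordOf-unique (proj₁ P) (trans P≡Q (sym (toList-wordOf (proj₁ Q)))))
      ; inverse   = (λ {P} T≡ → trans (cong (toList ∘ rowWord) T≡) (toList-rowWord-decode P))
                  , (λ {T} {P} P≡ → trans (cong decode (wordOf-unique (proj₁ P) P≡)) (decode-rowWord T))
      }
      where
      toList-rowWord-decode : ∀ P → toList (rowWord (decode (wordOf (proj₁ P)))) ≡ proj₁ (proj₁ P)
      toList-rowWord-decode P = trans (cong toList (rowWord-decode (wordOf (proj₁ P)))) (toList-wordOf (proj₁ P))
      decode-rowWord : ∀ (T : SVT a b) → decode (rowWord (proj₁ T)) ≡ proj₁ T
      decode-rowWord (v , svt) = Filling.decode-rowWord lengths⁺ v svt

theorem4p2 : (n : ℕ) → 1 ≤ n → (a b : Vec ℕ n)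
    → ((j : Fin n) → 0 < lookup a j) → ((j : Fin n) → 0 < lookup b j)
    → Bijection (SVT-setoid a b) (I-setoid a b)
theorem4p2 zero    () a b _ _
theorem4p2 (suc m) _  a b a⁺ b⁺ = Inverse⇒Bijection (SVT↔I lengths⁺)
  where
  open TwoRowShape a b
  lengths⁺ : ∀ s j → 0 < lookup (lengths s) j
  lengths⁺ E = a⁺
  lengths⁺ N = b⁺
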